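{- Let $\Sigma$ be an ordered alphabet, $n\ge1$, and $\lambda_1,\lambda_2\in\mathcal{L}^{(n)}$. (a) It is not possible that $\lambda_1<\lambda_2\le\lambda_1^{n/|\lambda_1|}$. (b) If $\lambda_1<\lambda_2$, then $\lambda_1^{n/|\lambda_1|}<\lambda_2^{n/|\lambda_2|}$.
   Context: Words are compared lexicographically. A Lyndon word is a primitive word strictly smaller than all its nontrivial cyclic rotations. $\mathcal{L}^{(n)}$ is the set of Lyndon words over $\Sigma$ whose length divides $n$; $u^k$ is the concatenation of $k$ copies of $u$. -}

module Defs where

open import Level using (Level)
open import Data.Nat using (ℕ; zero; suc; _<_; _/_)
open import Data.Nat.Divisibility using (_∣_)
open import Data.List using (List; []; _∷_; _++_; length; take; drop; concat; replicate)
open import Data.Product using (_×_)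
open import Relation.Binary.Core using (Rel)
open import Relation.Binary.PropositionalEquality using (_≡_; _≢_)
open import Data.List.Relation.Binary.Lex.Strict using (Lex-<; Lex-≤)

module Words {a ℓ : Level} {A : Set a} (_≺_ : Rel A ℓ) where

  -- strict lexicographic order on words (a proper prefix is smaller)
  _<ʷ_ : List A → List A → Set _
  _<ʷ_ = Lex-< _≡_ _≺_

  _≤ʷ_ : List A → List A → Set _
  _≤ʷ_ = Lex-≤ _≡_ _≺_

  _^ʷ_ : List A → ℕ → List A
  u ^ʷ k = concat (replicate k u)

  rotate : ℕ → List A → List A
  rotate i w = drop i w ++ take i w

  Primitive : List A → Set a
  Primitive w = (w ≢ []) × (∀ (u : List A) (k : ℕ) → w ≡ u ^ʷ k → k ≡ 1)

  Lyndon : List A → Set _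
  Lyndon w = Primitive w × (∀ i → 0 < i → i < length w → w <ʷ rotate i w)

  Lyn⁽_⁾ : ℕ → List A → Set _
  Lyn⁽ n ⁾ w = Lyndon w × (length w ∣ n)

  -- w ^ (n / |w|)  (for the empty word, which is never Lyndon, we return [])
  fullPow : ℕ → List A → List A
  fullPow n [] = []
  fullPow n (x ∷ xs) = (x ∷ xs) ^ʷ (n / length (x ∷ xs))

-- Write u ≪ v when u and v differ at some position inside both words and u
-- carries the smaller letter there.  Unlike the lexicographic order, ≪ survives
-- appending arbitrary words to either side, and it is asymmetric against every
-- lexicographic comparison (strict or not).
--
-- The heart of the proof is the power-prefix lemma: if a Lyndon word w has the
-- form u^(j+1) s with s nonempty and |s| ≤ m|u|, then u^m ≪ s.  It is proved by
-- induction on m, comparing u with s; each alternative is ruled out by a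
-- rotation of w, by primitivity of w, or by the fact that a Lyndon word has no
-- nonempty proper border.  From it: if λ₁ < λ₂, λ₂ is Lyndon and
-- |λ₂| ≤ (k+1)|λ₁|, then λ₁^(k+1) ≪ λ₂.  For λ₁, λ₂ ∈ 𝓛⁽ⁿ⁾ we have
-- fullPow n λ₁ = λ₁^(n/|λ₁|) with |λ₂| ≤ n, so fullPow n λ₁ ≪ λ₂.  Part (a) is
-- then asymmetry of ≪, and part (b) appends the rest of fullPow n λ₂ to λ₂.
module Submission where

open import Defs
open import Level using (Level; _⊔_)
open import Data.Nat using (ℕ; _≥_; zero; suc; _+_; _*_; _≤_; _<_; _/_; z<s; >-nonZero)
open import Data.Nat.Properties using (+-cancelˡ-≤; +-cancelˡ-≡; +-comm; <-irrefl; m<m+n)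
open import Data.Nat.Divisibility using (_∣_; divides; ∣⇒≤)
open import Data.Nat.DivMod using (m*n/n≡m)
open import Data.List using (List; []; _∷_; _++_; length; take; drop)
open import Data.List.Properties using (++-identityʳ; ++-assoc; length-++; ++-conicalˡ)
open import Data.List.Relation.Binary.Lex.Core using (Lex; halt; this; next)
open import Data.Product using (_×_; _,_; Σ-syntax)
open import Data.Sum using (_⊎_; inj₁; inj₂)
open import Data.Empty using (⊥; ⊥-elim)
open import Relation.Binary.Core using (Rel)
open import Relation.Binary.PropositionalEquality
  using (_≡_; _≢_; refl; sym; trans; cong; cong₂; subst; module ≡-Reasoning)
open import Relation.Binary.Structures using (IsStrictTotalOrder)
open import Relation.Binary.Definitions using (tri<; tri≈; tri>)
open import Relation.Nullary using (¬_)
open import Function using (_$_)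

module LyndonPowers {a ℓ : Level} {A : Set a} (_≺_ : Rel A ℓ)
                    (sto : IsStrictTotalOrder _≡_ _≺_) where
  open Words _≺_
  open IsStrictTotalOrder sto using (compare; irrefl; asym)

  infix 4 _≪_
  data _≪_ : List A → List A → Set (a ⊔ ℓ) where
    here  : ∀ {x y xs ys} → x ≺ y → (x ∷ xs) ≪ (y ∷ ys)
    there : ∀ {x xs ys} → xs ≪ ys → (x ∷ xs) ≪ (x ∷ ys)

  ≪⇒<ʷ : ∀ {xs ys} → xs ≪ ys → xs <ʷ ys
  ≪⇒<ʷ (here x≺y) = this x≺y
  ≪⇒<ʷ (there xs≪ys) = next refl (≪⇒<ʷ xs≪ys)

  ≪-++ˡ : ∀ {xs ys} → xs ≪ ys → ∀ zs → (xs ++ zs) ≪ ys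
  ≪-++ˡ (here x≺y) zs = here x≺y
  ≪-++ˡ (there xs≪ys) zs = there (≪-++ˡ xs≪ys zs)

  ≪-++ʳ : ∀ {xs ys} → xs ≪ ys → ∀ zs → xs ≪ (ys ++ zs)
  ≪-++ʳ (here x≺y) zs = here x≺y
  ≪-++ʳ (there xs≪ys) zs = there (≪-++ʳ xs≪ys zs)

  ≪-++ : ∀ {xs ys} → xs ≪ ys → ∀ zs zs′ → (xs ++ zs) ≪ (ys ++ zs′)
  ≪-++ xs≪ys zs zs′ = ≪-++ʳ (≪-++ˡ xs≪ys zs) zs′

  ≪-prefix : ∀ p {xs ys} → xs ≪ ys → (p ++ xs) ≪ (p ++ ys)
  ≪-prefix [] xs≪ys = xs≪ys
  ≪-prefix (x ∷ p) xs≪ys = there (≪-prefix p xs≪ys)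

  ≪-asym : ∀ {P : Set} {xs ys} → xs ≪ ys → ¬ Lex P _≡_ _≺_ ys xs
  ≪-asym (here x≺y) (this y≺x) = asym x≺y y≺x
  ≪-asym (here x≺y) (next refl _) = irrefl refl x≺y
  ≪-asym (there _) (this x≺x) = irrefl refl x≺x
  ≪-asym (there xs≪ys) (next _ ys<xs) = ≪-asym xs≪ys ys<xs

  <ʷ-prefix-or-≪ : ∀ {xs ys} → xs <ʷ ys →
                   (Σ[ u ∈ List A ] u ≢ [] × ys ≡ xs ++ u) ⊎ xs ≪ ys
  <ʷ-prefix-or-≪ (halt {y} {ys}) = inj₁ (y ∷ ys , (λ ()) , refl)
  <ʷ-prefix-or-≪ (this x≺y) = inj₂ (here x≺y)
  <ʷ-prefix-or-≪ (next refl xs<ys) with <ʷ-prefix-or-≪ xs<ys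
  ... | inj₁ (u , u≢[] , refl) = inj₁ (u , u≢[] , refl)
  ... | inj₂ xs≪ys = inj₂ (there xs≪ys)

  length-<-++ : ∀ (xs ys : List A) → ys ≢ [] → length xs < length (xs ++ ys)
  length-<-++ xs [] ys≢[] = ⊥-elim (ys≢[] refl)
  length-<-++ xs (y ∷ ys) _ =
    subst (length xs <_) (sym (length-++ xs)) (m<m+n (length xs) z<s)

  <ʷ-same-length⇒≪ : ∀ {xs ys} → length xs ≡ length ys → xs <ʷ ys → xs ≪ ys
  <ʷ-same-length⇒≪ {xs} |xs|≡|ys| xs<ys with <ʷ-prefix-or-≪ xs<ys
  ... | inj₁ (u , u≢[] , refl) =
    ⊥-elim (<-irrefl |xs|≡|ys| (length-<-++ xs u u≢[]))
  ... | inj₂ xs≪ys = xs≪ys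

  <ʷ-cancel : ∀ p {xs ys} → (p ++ xs) <ʷ (p ++ ys) → xs <ʷ ys
  <ʷ-cancel [] xs<ys = xs<ys
  <ʷ-cancel (x ∷ p) (this x≺x) = ⊥-elim (irrefl refl x≺x)
  <ʷ-cancel (x ∷ p) (next _ lt) = <ʷ-cancel p lt

  data Comparison (xs ys : List A) : Set (a ⊔ ℓ) where
    mismatchˡ : xs ≪ ys → Comparison xs ys
    mismatchʳ : ys ≪ xs → Comparison xs ys
    prefixˡ   : ∀ t → ys ≡ xs ++ t → Comparison xs ys
    prefixʳ   : ∀ r → r ≢ [] → xs ≡ ys ++ r → Comparison xs ys

  compareWords : ∀ xs ys → Comparison xs ys
  compareWords [] ys = prefixˡ ys refl
  compareWords (x ∷ xs) [] = prefixʳ (x ∷ xs) (λ ()) refl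
  compareWords (x ∷ xs) (y ∷ ys) with compare x y
  ... | tri< x≺y _ _ = mismatchˡ (here x≺y)
  ... | tri> _ _ y≺x = mismatchʳ (here y≺x)
  ... | tri≈ _ refl _ with compareWords xs ys
  ... | mismatchˡ xs≪ys = mismatchˡ (there xs≪ys)
  ... | mismatchʳ ys≪xs = mismatchʳ (there ys≪xs)
  ... | prefixˡ t eq = prefixˡ t (cong (x ∷_) eq)
  ... | prefixʳ r r≢[] eq = prefixʳ r r≢[] (cong (x ∷_) eq)

  rotate-++ : ∀ (p s : List A) → rotate (length p) (p ++ s) ≡ s ++ p
  rotate-++ p s = cong₂ _++_ (drop-++ p) (take-++ p)
    where
    drop-++ : ∀ p → drop (length p) (p ++ s) ≡ s
    drop-++ [] = refl
    drop-++ (x ∷ p) = drop-++ p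
    take-++ : ∀ p → take (length p) (p ++ s) ≡ p
    take-++ [] = refl
    take-++ (x ∷ p) = cong (x ∷_) (take-++ p)

  lyndon-<-rotation : ∀ {w} → Lyndon w → ∀ p s → w ≡ p ++ s →
                      p ≢ [] → s ≢ [] → w <ʷ (s ++ p)
  lyndon-<-rotation (_ , <rot) [] s refl p≢[] s≢[] = ⊥-elim (p≢[] refl)
  lyndon-<-rotation (_ , <rot) (x ∷ p) s refl _ s≢[] =
    subst (((x ∷ p) ++ s) <ʷ_) (rotate-++ (x ∷ p) s)
          (<rot (length (x ∷ p)) z<s (length-<-++ (x ∷ p) s s≢[]))

  -- Rotating Z s gives X < Z, a mismatch since |X| = |Z|; hence X s ≪ Z s = w,
  -- contradicting w < X s, the rotation of s X.
  lyndon-unbordered : ∀ {w} → Lyndon w → ∀ s X Z → w ≡ s ++ X → w ≡ Z ++ s →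
                      s ≢ [] → X ≢ [] → Z ≢ [] → ⊥
  lyndon-unbordered L s X Z w≡sX w≡Zs s≢[] X≢[] Z≢[] =
    ≪-asym (subst ((X ++ s) ≪_) (sym w≡Zs) (≪-++ X≪Z s s))
           (lyndon-<-rotation L s X w≡sX s≢[] X≢[])
    where
    sX<sZ : (s ++ X) <ʷ (s ++ Z)
    sX<sZ = subst (_<ʷ (s ++ Z)) w≡sX (lyndon-<-rotation L Z s w≡Zs Z≢[] s≢[])
    |X|≡|Z| : length X ≡ length Z
    |X|≡|Z| = +-cancelˡ-≡ (length s) _ _ (begin
      length s + length X  ≡⟨ sym (length-++ s) ⟩
      length (s ++ X)      ≡⟨ cong length (trans (sym w≡sX) w≡Zs) ⟩
      length (Z ++ s)      ≡⟨ length-++ Z ⟩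
      length Z + length s  ≡⟨ +-comm (length Z) (length s) ⟩
      length s + length Z  ∎)
      where open ≡-Reasoning
    X≪Z : X ≪ Z
    X≪Z = <ʷ-same-length⇒≪ |X|≡|Z| (<ʷ-cancel s sX<sZ)

  ^ʷ-snoc : ∀ (u : List A) j → u ^ʷ j ++ u ≡ u ^ʷ suc j
  ^ʷ-snoc u zero = sym (++-identityʳ u)
  ^ʷ-snoc u (suc j) = trans (++-assoc u (u ^ʷ j) u) (cong (u ++_) (^ʷ-snoc u j))

  lyndon-nonempty : ∀ {w} → Lyndon w → w ≢ []
  lyndon-nonempty ((w≢[] , _) , _) = w≢[]

  lyndon-not-power : ∀ {w} → Lyndon w → ∀ u k → w ≢ u ^ʷ suc (suc k)
  lyndon-not-power ((_ , not-power) , _) u k w≡ with not-power u (suc (suc k)) w≡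
  ... | ()

  lyndon-power-prefix : ∀ {w} → Lyndon w → ∀ {u} → u ≢ [] → ∀ j m s →
                        w ≡ u ^ʷ suc j ++ s → s ≢ [] → length s ≤ m * length u →
                        u ^ʷ m ≪ s
  lyndon-power-prefix L u≢[] j m [] w≡ s≢[] _ = ⊥-elim (s≢[] refl)
  lyndon-power-prefix L u≢[] j zero (x ∷ s) w≡ _ ()
  lyndon-power-prefix {w} L {u} u≢[] j (suc m) s w≡ s≢[] |s|≤ with compareWords u s
  ... | mismatchˡ u≪s = ≪-++ˡ u≪s (u ^ʷ m)
  -- s ≪ u would make the rotation s u^(j+1) smaller than w.
  ... | mismatchʳ s≪u = ⊥-elim $
    ≪-asym (subst ((s ++ u ^ʷ suc j) ≪_) w≡′ (≪-++ s≪u (u ^ʷ suc j) (u ^ʷ j ++ s)))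
           (lyndon-<-rotation L (u ^ʷ suc j) s w≡ (λ eq → u≢[] (++-conicalˡ u _ eq)) s≢[])
    where
    w≡′ : u ++ (u ^ʷ j ++ s) ≡ w
    w≡′ = sym (trans w≡ (++-assoc u (u ^ʷ j) s))
  -- s = u: then w = u^(j+2) is a proper power.
  ... | prefixˡ [] refl = ⊥-elim $
    lyndon-not-power L u j (trans w≡ (trans (cong (u ^ʷ suc j ++_) (++-identityʳ u)) (^ʷ-snoc u (suc j))))
  -- s = u t with t nonempty: w = u^(j+2) t, and t is shorter by |u|; recurse.
  ... | prefixˡ t@(_ ∷ _) refl =
    ≪-prefix u (lyndon-power-prefix L u≢[] (suc j) m t w≡ᵗ (λ ()) |t|≤)
    where
    w≡ᵗ : w ≡ u ^ʷ suc (suc j) ++ t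
    w≡ᵗ = trans w≡ (trans (sym (++-assoc (u ^ʷ suc j) u t))
                          (cong (_++ t) (^ʷ-snoc u (suc j))))
    |t|≤ : length t ≤ m * length u
    |t|≤ = +-cancelˡ-≤ (length u) _ _ (subst (_≤ length u + m * length u) (length-++ u) |s|≤)
  -- u = s r with r nonempty makes s a proper border of w.
  ... | prefixʳ r r≢[] refl = ⊥-elim $
    lyndon-unbordered L s (r ++ (u ^ʷ j ++ s)) (u ^ʷ suc j) w≡sX w≡ s≢[]
      (λ eq → r≢[] (++-conicalˡ r _ eq)) (λ eq → s≢[] (++-conicalˡ s _ (++-conicalˡ u _ eq)))
    where
    w≡sX : w ≡ s ++ (r ++ (u ^ʷ j ++ s))
    w≡sX = trans w≡ (trans (++-assoc (s ++ r) (u ^ʷ j) s) (++-assoc s r (u ^ʷ j ++ s)))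

  power-≪-lyndon : ∀ {λ₁ λ₂} k → λ₁ ≢ [] → Lyndon λ₂ → λ₁ <ʷ λ₂ →
                   length λ₂ ≤ suc k * length λ₁ → λ₁ ^ʷ suc k ≪ λ₂
  power-≪-lyndon {λ₁} {λ₂} k λ₁≢[] L₂ λ₁<λ₂ |λ₂|≤ with <ʷ-prefix-or-≪ λ₁<λ₂
  ... | inj₂ λ₁≪λ₂ = ≪-++ˡ λ₁≪λ₂ (λ₁ ^ʷ k)
  ... | inj₁ (u , u≢[] , refl) =
    ≪-prefix λ₁ (lyndon-power-prefix L₂ λ₁≢[] 0 k u λ₂≡ u≢[] |u|≤)
    where
    λ₂≡ : λ₁ ++ u ≡ λ₁ ^ʷ 1 ++ u
    λ₂≡ = cong (_++ u) (sym (++-identityʳ λ₁))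
    |u|≤ : length u ≤ k * length λ₁
    |u|≤ = +-cancelˡ-≤ (length λ₁) _ _ (subst (_≤ suc k * length λ₁) (length-++ λ₁) |λ₂|≤)

  fullPow-power : ∀ n → n ≥ 1 → ∀ {w} → w ≢ [] → length w ∣ n →
                  Σ[ k ∈ ℕ ] n ≡ suc k * length w × fullPow n w ≡ w ^ʷ suc k
  fullPow-power n n≥1 {[]} w≢[] _ = ⊥-elim (w≢[] refl)
  fullPow-power n n≥1 {x ∷ xs} _ (divides zero refl) with n≥1
  ... | ()
  fullPow-power n n≥1 {x ∷ xs} _ (divides (suc k) n≡) =
    k , n≡ , cong ((x ∷ xs) ^ʷ_) (trans (cong (_/ length (x ∷ xs)) n≡)
                                        (m*n/n≡m (suc k) (length (x ∷ xs))))

  theorem : (n : ℕ) → n ≥ 1 → (λ₁ λ₂ : List A) → Lyn⁽ n ⁾ λ₁ → Lyn⁽ n ⁾ λ₂ →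
            (¬ (λ₁ <ʷ λ₂ × λ₂ ≤ʷ fullPow n λ₁))
            × (λ₁ <ʷ λ₂ → fullPow n λ₁ <ʷ fullPow n λ₂)
  theorem n n≥1 λ₁ λ₂ (L₁ , |λ₁|∣n) (L₂ , |λ₂|∣n)
    with fullPow-power n n≥1 (lyndon-nonempty L₁) |λ₁|∣n
       | fullPow-power n n≥1 (lyndon-nonempty L₂) |λ₂|∣n
  ... | k₁ , n≡ , fp₁≡ | k₂ , _ , fp₂≡ = part-a , part-b
    where
    fp₁≪λ₂ : λ₁ <ʷ λ₂ → fullPow n λ₁ ≪ λ₂
    fp₁≪λ₂ λ₁<λ₂ = subst (_≪ λ₂) (sym fp₁≡)
      (power-≪-lyndon k₁ (lyndon-nonempty L₁) L₂ λ₁<λ₂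
        (subst (length λ₂ ≤_) n≡ (∣⇒≤ {{>-nonZero n≥1}} |λ₂|∣n)))
    part-a : ¬ (λ₁ <ʷ λ₂ × λ₂ ≤ʷ fullPow n λ₁)
    part-a (λ₁<λ₂ , λ₂≤fp₁) = ≪-asym (fp₁≪λ₂ λ₁<λ₂) λ₂≤fp₁
    part-b : λ₁ <ʷ λ₂ → fullPow n λ₁ <ʷ fullPow n λ₂
    part-b λ₁<λ₂ = subst (fullPow n λ₁ <ʷ_) (sym fp₂≡) (≪⇒<ʷ (≪-++ʳ (fp₁≪λ₂ λ₁<λ₂) (λ₂ ^ʷ k₂)))

mainTheorem17 : {a ℓ : Level} {A : Set a} (_≺_ : Rel A ℓ) → IsStrictTotalOrder _≡_ _≺_ →
    let open Words _≺_ in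
    (n : ℕ) → n ≥ 1 → (λ₁ λ₂ : List A) → Lyn⁽ n ⁾ λ₁ → Lyn⁽ n ⁾ λ₂ →
    (¬ (λ₁ <ʷ λ₂ × λ₂ ≤ʷ fullPow n λ₁))
    × (λ₁ <ʷ λ₂ → fullPow n λ₁ <ʷ fullPow n λ₂)
mainTheorem17 _≺_ sto = LyndonPowers.theorem _≺_ sto
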